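{- Let $G$ be a finite transitive permutation group on $\Omega$ and let $H_G$ be the subgroup generated by all elements of $G$ fixing at least one point of $\Omega$. (1) If $H_G=\{1\}$, then $\Gamma_G$ is a complete graph and $G$ acts regularly; in particular $G$ has the EKR-property and $\rho(G)=1$. (2) If $H_G$ is a proper subgroup of $G$, then $\Gamma_G$ is a join of $[G:H_G]$ copies of $\Gamma_{H_G}$; further $\alpha(\Gamma_G)=\alpha(\Gamma_{H_G})$ and $\rho(G)=\rho(H_G)$. (3) If $H_G=G$, then $\Gamma_G$ is not a join.
   Context: For a permutation group $K$ on $\Omega$, the derangement graph $\Gamma_K$ has vertex set $K$, with $g,h$ adjacent iff $gh^{ -1}$ is a derangement (fixed-point-free). $\alpha$ denotes independence number. A subset $\mathcal{F}\subseteq K$ is intersecting if for all $g,h\in\mathcal{F}$ some $\omega\in\Omega$ has $\omega^g=\omega^h$; with $K_\omega$ a point stabilizer of maximum size, $\rho(K)=\max\{|\mathcal{F}|/|K_\omega|:\mathcal{F}\text{ intersecting}\}$. A transitive group has the EKR-property if the maximum size of an intersecting family is $|K|/|\Omega|$. A graph is a join of graphs if its vertex set can be partitioned into parts with every vertex of one part adjacent to every vertex of every other part. -}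

module Defs where

open import Data.Nat using (ℕ; _*_; _≤_; _<_)
open import Data.Fin using (Fin; _≟_)
open import Data.Fin.Base using ()
open import Data.Vec using (Vec; lookup; tabulate; allFin)
open import Data.Vec.Properties using ()
open import Data.List using (List; []; _∷_; length; filter)
open import Data.List.Membership.Propositional using (_∈_; _∉_)
open import Data.List.Relation.Unary.Unique.Propositional using (Unique)
open import Data.Product using (Σ; ∃; ∃-syntax; _×_; _,_)
open import Relation.Nullary using (¬_; does)
open import Relation.Binary.PropositionalEquality using (_≡_; _≢_)
open import Data.Bool using (if_then_else_)
open import Function.Definitions using (Injective)

-- Permutations of Ω = Fin n, represented by their value tables.
-- ω ^ g  =  lookup g ω.

Perm : ℕ → Set
Perm n = Vec (Fin n) n

_^_ : ∀ {n} → Fin n → Perm n → Fin n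
ω ^ g = lookup g ω

-- g is genuinely a permutation (injective, hence bijective, on Fin n)
IsPerm : ∀ {n} → Perm n → Set
IsPerm g = Injective _≡_ _≡_ (lookup g)

idP : ∀ {n} → Perm n
idP {n} = tabulate (λ ω → ω)

-- right action convention:  ω ^ (g · h) = (ω ^ g) ^ h
_·_ : ∀ {n} → Perm n → Perm n → Perm n
g · h = tabulate (λ ω → (ω ^ g) ^ h)

-- inverse: j ↦ the (first) i with i ^ g = j  (default j, never used for permutations)
preimage : ∀ {n} → Perm n → Fin n → List (Fin n) → Fin n
preimage g j [] = j
preimage g j (i ∷ is) = if does (i ^ g ≟ j) then i else preimage g j is

inv : ∀ {n} → Perm n → Perm n
inv {n} g = tabulate (λ j → preimage g j (Data.List.Base.tabulate (λ i → i)))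
  where import Data.List.Base

record PermGroup (n : ℕ) : Set where
  field
    elems    : List (Perm n)
    unique   : Unique elems
    perms    : ∀ {g} → g ∈ elems → IsPerm g
    hasId    : idP ∈ elems
    closed·  : ∀ {g h} → g ∈ elems → h ∈ elems → (g · h) ∈ elems
    closedInv : ∀ {g} → g ∈ elems → inv g ∈ elems
open PermGroup public

order : ∀ {n} → PermGroup n → ℕ
order K = length (elems K)

Transitive : ∀ {n} → PermGroup n → Set
Transitive {n} K = ∀ (α β : Fin n) → ∃[ g ] (g ∈ elems K × α ^ g ≡ β)

Regular : ∀ {n} → PermGroup n → Set
Regular {n} K = Transitive K × (∀ {g} → g ∈ elems K → ∀ (ω : Fin n) → ω ^ g ≡ ω → g ≡ idP)

FixesAPoint : ∀ {n} → Perm n → Set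
FixesAPoint {n} g = ∃[ ω ] (ω ^ g ≡ ω)

data InH {n} (G : PermGroup n) : Perm n → Set where
  gen  : ∀ {g} → g ∈ elems G → FixesAPoint g → InH G g
  gid  : InH G idP
  gmul : ∀ {g h} → InH G g → InH G h → InH G (g · h)
  ginv : ∀ {g} → InH G g → InH G (inv g)

IsH : ∀ {n} → PermGroup n → PermGroup n → Set
IsH {n} G H = ∀ (g : Perm n) → (g ∈ elems H → InH G g) × (InH G g → g ∈ elems H)

-- Derangement graph Γ_K : vertices elems K, g ~ h iff g h⁻¹ is a derangement

Derangement : ∀ {n} → Perm n → Set
Derangement {n} g = ∀ (ω : Fin n) → ω ^ g ≢ ω

Adj : ∀ {n} → Perm n → Perm n → Set
Adj g h = Derangement (g · inv h)

IsComplete : ∀ {n} → PermGroup n → Set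
IsComplete K = ∀ {g h} → g ∈ elems K → h ∈ elems K → g ≢ h → Adj g h

JoinDecomp : ∀ {n} → PermGroup n → (k : ℕ) → (Fin k → List (Perm n)) → Set
JoinDecomp {n} K k part =
    (∀ i {g} → g ∈ part i → g ∈ elems K)
  × (∀ {g} → g ∈ elems K → ∃[ i ] (g ∈ part i))
  × (∀ i j {g} → i ≢ j → g ∈ part i → g ∉ part j)
  × (∀ i j {x y} → i ≢ j → x ∈ part i → y ∈ part j → Adj x y)

IsJoin : ∀ {n} → PermGroup n → Set
IsJoin {n} K = ∃[ k ] Σ (Fin k → List (Perm n)) λ part →
  2 ≤ k × JoinDecomp K k part × (∀ i → ∃[ g ] (g ∈ part i))

InducedIsoTo : ∀ {n} → List (Perm n) → PermGroup n → Set
InducedIsoTo {n} P H = Σ (Perm n → Perm n) λ f →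
    (∀ {x} → x ∈ P → f x ∈ elems H)
  × (∀ {x y} → x ∈ P → y ∈ P → f x ≡ f y → x ≡ y)
  × (∀ {y} → y ∈ elems H → ∃[ x ] (x ∈ P × f x ≡ y))
  × (∀ {x y} → x ∈ P → y ∈ P → (Adj x y → Adj (f x) (f y)) × (Adj (f x) (f y) → Adj x y))

IsJoinOfCopies : ∀ {n} → PermGroup n → ℕ → PermGroup n → Set
IsJoinOfCopies {n} K k H = Σ (Fin k → List (Perm n)) λ part →
  JoinDecomp K k part × (∀ i → InducedIsoTo (part i) H)

Family : ∀ {n} → PermGroup n → (Perm n → Perm n → Set) → List (Perm n) → Set
Family K R F = Unique F × (∀ {g} → g ∈ F → g ∈ elems K)
             × (∀ {g h} → g ∈ F → h ∈ F → R g h)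

IsMaxFamilySize : ∀ {n} → PermGroup n → (Perm n → Perm n → Set) → ℕ → Set
IsMaxFamilySize {n} K R m =
  (∃[ F ] (Family K R F × length F ≡ m)) × (∀ F → Family K R F → length F ≤ m)

Intersects : ∀ {n} → Perm n → Perm n → Set
Intersects {n} g h = ∃[ ω ] (ω ^ g ≡ ω ^ h)

IsMaxIntersecting : ∀ {n} → PermGroup n → ℕ → Set
IsMaxIntersecting K m = IsMaxFamilySize K Intersects m

IsAlpha : ∀ {n} → PermGroup n → ℕ → Set
IsAlpha K a = IsMaxFamilySize K (λ g h → ¬ Adj g h) a

stab : ∀ {n} → PermGroup n → Fin n → List (Perm n)
stab K ω = filter (λ g → ω ^ g ≟ ω) (elems K)

IsMaxStab : ∀ {n} → PermGroup n → ℕ → Set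
IsMaxStab {n} K s = (∃[ ω ] (length (stab K ω) ≡ s)) × (∀ (ω : Fin n) → length (stab K ω) ≤ s)

-- ρ(K) = m / s  (as a rational, recorded by the pair (m , s))
RhoIs : ∀ {n} → PermGroup n → ℕ → ℕ → Set
RhoIs K m s = IsMaxIntersecting K m × IsMaxStab K s

EKR : ∀ {n} → PermGroup n → Set
EKR {n} K = ∃[ m ] (IsMaxIntersecting K m × m * n ≡ order K)

-- For g, h ∈ G the quotient
-- g h⁻¹ fixes a point exactly when g and h intersect, and exactly when they are non-adjacent
-- in Γ_G; in either case g h⁻¹ ∈ H. Hence elements of distinct right cosets of H are always
-- adjacent, right translation by r⁻¹ maps the coset Hr onto H preserving adjacency, and
-- translating an intersecting family or an independent set of Γ_G by the inverse of one of its
-- members moves it into H without changing its size. All point stabilisers of G lie in H.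
-- If H = 1, then G is semiregular, so elements agreeing at one point coincide. If H = G, each
-- part of a join decomposition of Γ_G is closed under left multiplication by point-fixing
-- elements (g x is not adjacent to x when g fixes a point), hence by all of G, so the part
-- containing 1 is everything.

module Submission where

open import Defs
open import Data.Nat using (ℕ; zero; suc; _+_; _*_; _≤_; _<_; z≤n; s≤s)
open import Data.Nat.Properties using (≤-antisym; ≤-reflexive; *-identityˡ; 1+n≰n)
open import Data.Fin using (Fin; _≟_; punchOut; fromℕ<)
open import Data.Fin.Properties using (any?; all?; ¬∀⟶∃¬; injective⇒≤; punchOut-injective)
open import Data.Vec.Properties using (lookup∘tabulate; tabulate∘lookup; tabulate-cong; ≡-dec)
open import Data.List using (List; []; _∷_; length; lookup; filter; map; _++_; concat; tabulate; allFin; deduplicate)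
open import Data.List.Properties using (length-++; length-tabulate; length-map)
open import Data.List.Membership.Propositional using (_∈_; _∉_; find; lose)
open import Data.List.Membership.Propositional.Properties using (∈-lookup; ∈-map⁺; ∈-++⁺ˡ; ∈-++⁺ʳ; ∈-concat⁺′; ∈-concat⁻′; ∈-tabulate⁺; ∈-tabulate⁻; ∈-allFin; ∈-filter⁺; ∈-filter⁻; ∈-map⁻; ∈-deduplicate⁻)
open import Data.List.Relation.Binary.Subset.Propositional using (_⊆_)
open import Data.List.Relation.Unary.Any using (here; there; index)
import Data.List.Relation.Unary.Any.Properties as Any
open import Data.List.Relation.Unary.Any.Properties using (lookup-index)
open import Data.List.Relation.Unary.All as All using (All)
import Data.List.Relation.Unary.All.Properties as All
open import Data.List.Relation.Unary.AllPairs using (AllPairs; []; _∷_)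
import Data.List.Relation.Unary.AllPairs.Properties as AllPairs
open import Data.List.Relation.Unary.Unique.Propositional using (Unique)
import Data.List.Relation.Unary.Unique.Propositional.Properties as Unique
open import Data.Product using (∃-syntax; _×_; _,_; proj₁; proj₂)
open import Data.Sum using (_⊎_; inj₁; inj₂)
open import Data.Bool using (true; false)
open import Relation.Nullary using (¬_; ¬?; yes; no; Dec; does)
open import Relation.Nullary.Negation using (contradiction)
open import Relation.Nullary.Decidable using (map′; decidable-stable; _×-dec_)
open import Data.List.Extrema.Nat using (argmax; argmax-all; f[xs]≤f[argmax])
import Data.List.Membership.DecPropositional as DecMembership
import Data.List.Relation.Unary.Unique.DecPropositional as DecUnique
open import Relation.Binary.PropositionalEquality using (_≡_; _≢_; refl; sym; trans; cong; cong₂; subst; module ≡-Reasoning)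
open import Function using (id; _∘_)


-- Counting in duplicate-free lists

module _ {a} {A : Set a} where

  AllPairs-lookup : ∀ {r} {R : A → A → Set r} {xs} → AllPairs R xs → ∀ {i j} → i ≢ j →
                    R (lookup xs i) (lookup xs j) ⊎ R (lookup xs j) (lookup xs i)
  AllPairs-lookup (px ∷ _)  {Fin.zero}  {Fin.zero}  i≢j = contradiction refl i≢j
  AllPairs-lookup (px ∷ _)  {Fin.zero}  {Fin.suc j} _   = inj₁ (All.lookup px (∈-lookup j))
  AllPairs-lookup (px ∷ _)  {Fin.suc i} {Fin.zero}  _   = inj₂ (All.lookup px (∈-lookup i))
  AllPairs-lookup (_ ∷ pxs) {Fin.suc i} {Fin.suc j} i≢j = AllPairs-lookup pxs (i≢j ∘ cong Fin.suc)

  AllPairs¬⇒lookup-injective : ∀ {r} {S : A → A → Set r} {xs} → AllPairs (λ x y → ¬ S x y) xs →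
                               ∀ {i j} → S (lookup xs i) (lookup xs j) → S (lookup xs j) (lookup xs i) → i ≡ j
  AllPairs¬⇒lookup-injective ps {i} {j} sᵢⱼ sⱼᵢ with i ≟ j
  ... | yes i≡j = i≡j
  ... | no  i≢j with AllPairs-lookup ps i≢j
  ...   | inj₁ ¬sᵢⱼ = contradiction sᵢⱼ ¬sᵢⱼ
  ...   | inj₂ ¬sⱼᵢ = contradiction sⱼᵢ ¬sⱼᵢ

  Unique-lookup-injective : ∀ {xs} → Unique xs → ∀ {i j} → lookup xs i ≡ lookup xs j → i ≡ j
  Unique-lookup-injective u eq = AllPairs¬⇒lookup-injective u eq (sym eq)

  injectiveOn⇒length≤ : ∀ {b} {B : Set b} {xs : List A} {ys : List B} (f : A → B) → Unique xs →
                        (∀ {x} → x ∈ xs → f x ∈ ys) →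
                        (∀ {x y} → x ∈ xs → y ∈ xs → f x ≡ f y → x ≡ y) →
                        length xs ≤ length ys
  injectiveOn⇒length≤ {xs = xs} {ys} f u into inj = injective⇒≤ index-injective
    where
    f-index : Fin (length xs) → Fin (length ys)
    f-index i = index (into (∈-lookup i))

    index-injective : ∀ {i j} → f-index i ≡ f-index j → i ≡ j
    index-injective {i} {j} eq = Unique-lookup-injective u (inj (∈-lookup i) (∈-lookup j) (begin
      f (lookup xs i)            ≡⟨ lookup-index (into (∈-lookup i)) ⟩
      lookup ys (f-index i)      ≡⟨ cong (lookup ys) eq ⟩
      lookup ys (f-index j)      ≡⟨ lookup-index (into (∈-lookup j)) ⟨
      f (lookup xs j)            ∎))
      where open ≡-Reasoning

  ⊆-antisym⇒length≡ : ∀ {xs ys : List A} → Unique xs → Unique ys → xs ⊆ ys → ys ⊆ xs →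
                      length xs ≡ length ys
  ⊆-antisym⇒length≡ uxs uys xs⊆ys ys⊆xs = ≤-antisym
    (injectiveOn⇒length≤ id uxs xs⊆ys (λ _ _ eq → eq))
    (injectiveOn⇒length≤ id uys ys⊆xs (λ _ _ eq → eq))

  length-concat-tabulate : ∀ {k m} (f : Fin k → List A) → (∀ i → length (f i) ≡ m) →
                           length (concat (tabulate f)) ≡ k * m
  length-concat-tabulate {zero}  f len = refl
  length-concat-tabulate {suc k} f len = trans (length-++ (f Fin.zero))
    (cong₂ _+_ (len Fin.zero) (length-concat-tabulate (f ∘ Fin.suc) (len ∘ Fin.suc)))

  partition⇒length≡ : ∀ {k m} {xs : List A} (part : Fin k → List A) → Unique xs →
                      (∀ i → part i ⊆ xs) → (∀ {x} → x ∈ xs → ∃[ i ] (x ∈ part i)) →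
                      (∀ {i j x} → i ≢ j → x ∈ part i → x ∉ part j) →
                      (∀ i → Unique (part i)) → (∀ i → length (part i) ≡ m) →
                      length xs ≡ k * m
  partition⇒length≡ {xs = xs} part u part⊆ cover disjoint uparts len = begin
    length xs                           ≡⟨ ⊆-antisym⇒length≡ u uconcat into onto ⟩
    length (concat (tabulate part))     ≡⟨ length-concat-tabulate part len ⟩
    _                                   ∎
    where
    open ≡-Reasoning
    uconcat : Unique (concat (tabulate part))
    uconcat = Unique.concat⁺ (All.tabulate⁺ uparts)
      (AllPairs.tabulate⁺ (λ i≢j (x∈i , x∈j) → disjoint i≢j x∈i x∈j))
    into : xs ⊆ concat (tabulate part)
    into x∈xs = let (i , x∈i) = cover x∈xs in ∈-concat⁺′ x∈i (∈-tabulate⁺ i)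
    onto : concat (tabulate part) ⊆ xs
    onto x∈c with ∈-concat⁻′ (tabulate part) x∈c
    ... | ys , x∈ys , ys∈parts with ∈-tabulate⁻ ys∈parts
    ...   | i , refl = part⊆ i x∈ys

deduplicate-AllPairs¬ : ∀ {a r} {A : Set a} {R : A → A → Set r} (R? : ∀ x y → Dec (R x y)) xs →
                        AllPairs (λ x y → ¬ R x y) (deduplicate R? xs)
deduplicate-AllPairs¬ R? []       = []
deduplicate-AllPairs¬ R? (x ∷ xs) =
  All.all-filter (¬? ∘ R? x) (deduplicate R? xs) ∷ AllPairs.filter⁺ (¬? ∘ R? x) (deduplicate-AllPairs¬ R? xs)

sublists : ∀ {a} {A : Set a} → List A → List (List A)
sublists []       = [] ∷ []
sublists (x ∷ xs) = map (x ∷_) (sublists xs) ++ sublists xs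

filter∈sublists : ∀ {a p} {A : Set a} {P : A → Set p} (P? : ∀ x → Dec (P x)) xs →
                  filter P? xs ∈ sublists xs
filter∈sublists P? []       = here refl
filter∈sublists P? (x ∷ xs) with does (P? x)
... | true  = ∈-++⁺ˡ (∈-map⁺ (x ∷_) (filter∈sublists P? xs))
... | false = ∈-++⁺ʳ (map (x ∷_) (sublists xs)) (filter∈sublists P? xs)

-- Permutations of Fin n

module _ {n : ℕ} where

  ^-· : ∀ ω (g h : Perm n) → ω ^ (g · h) ≡ (ω ^ g) ^ h
  ^-· ω g h = lookup∘tabulate _ ω

  ^-idP : ∀ (ω : Fin n) → ω ^ idP ≡ ω
  ^-idP ω = lookup∘tabulate _ ω

  perm-ext : ∀ {g h : Perm n} → (∀ ω → ω ^ g ≡ ω ^ h) → g ≡ h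
  perm-ext {g} {h} g≗h = trans (sym (tabulate∘lookup g)) (trans (tabulate-cong g≗h) (tabulate∘lookup h))

  ·-assoc : ∀ (f g h : Perm n) → (f · g) · h ≡ f · (g · h)
  ·-assoc f g h = perm-ext λ ω → begin
    ω ^ ((f · g) · h)     ≡⟨ ^-· ω (f · g) h ⟩
    (ω ^ (f · g)) ^ h     ≡⟨ cong (_^ h) (^-· ω f g) ⟩
    ((ω ^ f) ^ g) ^ h     ≡⟨ ^-· (ω ^ f) g h ⟨
    (ω ^ f) ^ (g · h)     ≡⟨ ^-· ω f (g · h) ⟨
    ω ^ (f · (g · h))     ∎
    where open ≡-Reasoning

  ·-identityˡ : ∀ (g : Perm n) → idP · g ≡ g
  ·-identityˡ g = perm-ext λ ω → trans (^-· ω idP g) (cong (_^ g) (^-idP ω))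

  ·-identityʳ : ∀ (g : Perm n) → g · idP ≡ g
  ·-identityʳ g = perm-ext λ ω → trans (^-· ω g idP) (^-idP (ω ^ g))

  ·-isPerm : ∀ (g h : Perm n) → IsPerm g → IsPerm h → IsPerm (g · h)
  ·-isPerm g h g-inj h-inj {ω} {ω′} eq =
    g-inj (h-inj (trans (sym (^-· ω g h)) (trans eq (^-· ω′ g h))))

isPerm⇒surjective : ∀ {n} {g : Perm n} → IsPerm g → ∀ j → ∃[ i ] (i ^ g ≡ j)
isPerm⇒surjective {suc m} {g} g-inj j with any? (λ i → i ^ g ≟ j)
... | yes hit  = hit
... | no  miss = contradiction (injective⇒≤ squeezed-injective) 1+n≰n
  where
  unhit : ∀ i → j ≢ i ^ g
  unhit i j≡iᵍ = miss (i , sym j≡iᵍ)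
  squeezed : Fin (suc m) → Fin m
  squeezed i = punchOut (unhit i)
  squeezed-injective : ∀ {i i′} → squeezed i ≡ squeezed i′ → i ≡ i′
  squeezed-injective {i} {i′} eq = g-inj (punchOut-injective (unhit i) (unhit i′) eq)

preimage-spec : ∀ {n} (g : Perm n) j (is : List (Fin n)) → ∃[ i ] (i ∈ is × i ^ g ≡ j) →
                preimage g j is ^ g ≡ j
preimage-spec g j (i ∷ is) (i′ , i′∈ , i′ᵍ≡j) with i ^ g ≟ j
... | yes iᵍ≡j = iᵍ≡j
... | no  iᵍ≢j with i′∈
...   | here refl = contradiction i′ᵍ≡j iᵍ≢j
...   | there i′∈is = preimage-spec g j is (i′ , i′∈is , i′ᵍ≡j)

module _ {n : ℕ} (g : Perm n) (g-perm : IsPerm g) where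

  ^-inverseʳ : ∀ ω → (ω ^ inv g) ^ g ≡ ω
  ^-inverseʳ ω = trans (cong (_^ g) (lookup∘tabulate _ ω))
    (preimage-spec g ω _ (let (i , iᵍ≡ω) = isPerm⇒surjective {g = g} g-perm ω in i , ∈-allFin i , iᵍ≡ω))

  ^-inverseˡ : ∀ ω → (ω ^ g) ^ inv g ≡ ω
  ^-inverseˡ ω = g-perm (^-inverseʳ (ω ^ g))

  inv-isPerm : IsPerm (inv g)
  inv-isPerm {ω} {ω′} eq = begin
    ω                    ≡⟨ ^-inverseʳ ω ⟨
    (ω ^ inv g) ^ g      ≡⟨ cong (_^ g) eq ⟩
    (ω′ ^ inv g) ^ g     ≡⟨ ^-inverseʳ ω′ ⟩
    ω′                   ∎
    where open ≡-Reasoning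

  ·-inverseʳ : g · inv g ≡ idP
  ·-inverseʳ = perm-ext λ ω → trans (^-· ω g (inv g)) (trans (^-inverseˡ ω) (sym (^-idP ω)))

  ·-inverseˡ : inv g · g ≡ idP
  ·-inverseˡ = perm-ext λ ω → trans (^-· ω (inv g) g) (trans (^-inverseʳ ω) (sym (^-idP ω)))

  inverseʳ-unique : ∀ h → g · h ≡ idP → h ≡ inv g
  inverseʳ-unique h gh≡1 = begin
    h                    ≡⟨ ·-identityˡ h ⟨
    idP · h              ≡⟨ cong (_· h) ·-inverseˡ ⟨
    (inv g · g) · h      ≡⟨ ·-assoc (inv g) g h ⟩
    inv g · (g · h)      ≡⟨ cong (inv g ·_) gh≡1 ⟩
    inv g · idP          ≡⟨ ·-identityʳ (inv g) ⟩
    inv g                ∎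
    where open ≡-Reasoning

infixl 20 _//_

_//_ : ∀ {n} → Perm n → Perm n → Perm n
g // h = g · inv h

module _ {n : ℕ} where

  x//y·y≡x : ∀ (x y : Perm n) → IsPerm y → (x // y) · y ≡ x
  x//y·y≡x x y y-perm = begin
    (x · inv y) · y     ≡⟨ ·-assoc x (inv y) y ⟩
    x · (inv y · y)     ≡⟨ cong (x ·_) (·-inverseˡ y y-perm) ⟩
    x · idP             ≡⟨ ·-identityʳ x ⟩
    x                   ∎
    where open ≡-Reasoning

  x·y//y≡x : ∀ (x y : Perm n) → IsPerm y → (x · y) // y ≡ x
  x·y//y≡x x y y-perm = begin
    (x · y) · inv y     ≡⟨ ·-assoc x y (inv y) ⟩
    x · (y · inv y)     ≡⟨ cong (x ·_) (·-inverseʳ y y-perm) ⟩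
    x · idP             ≡⟨ ·-identityʳ x ⟩
    x                   ∎
    where open ≡-Reasoning

  //-cancelʳ : ∀ {x y} (z : Perm n) → IsPerm z → x // z ≡ y // z → x ≡ y
  //-cancelʳ {x} {y} z z-perm eq = begin
    x                 ≡⟨ x//y·y≡x x z z-perm ⟨
    (x // z) · z      ≡⟨ cong (_· z) eq ⟩
    (y // z) · z      ≡⟨ x//y·y≡x y z z-perm ⟩
    y                 ∎
    where open ≡-Reasoning

  ·-cancelʳ : ∀ {x y} (z : Perm n) → IsPerm z → x · z ≡ y · z → x ≡ y
  ·-cancelʳ {x} {y} z z-perm eq = begin
    x                 ≡⟨ x·y//y≡x x z z-perm ⟨
    (x · z) // z      ≡⟨ cong (_// z) eq ⟩
    (y · z) // z      ≡⟨ x·y//y≡x y z z-perm ⟩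
    y                 ∎
    where open ≡-Reasoning

  x//y≡idP⇒x≡y : ∀ {x} (y : Perm n) → IsPerm y → x // y ≡ idP → x ≡ y
  x//y≡idP⇒x≡y y y-perm eq = //-cancelʳ y y-perm (trans eq (sym (·-inverseʳ y y-perm)))

  x//y·y//z≡x//z : ∀ (x y z : Perm n) → IsPerm y → (x // y) · (y // z) ≡ x // z
  x//y·y//z≡x//z x y z y-perm = begin
    (x // y) · (y · inv z)     ≡⟨ ·-assoc (x // y) y (inv z) ⟨
    ((x // y) · y) · inv z     ≡⟨ cong (_· inv z) (x//y·y≡x x y y-perm) ⟩
    x // z                     ∎
    where open ≡-Reasoning

  inv-anti-homo-// : ∀ (x y : Perm n) → IsPerm x → IsPerm y → inv (x // y) ≡ y // x
  inv-anti-homo-// x y x-perm y-perm =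
    sym (inverseʳ-unique (x // y) (·-isPerm x (inv y) x-perm (inv-isPerm y y-perm)) (y // x)
      (trans (x//y·y//z≡x//z x y x y-perm) (·-inverseʳ x x-perm)))

  inv-anti-homo-· : ∀ (x y : Perm n) → IsPerm x → IsPerm y → inv (x · y) ≡ inv y · inv x
  inv-anti-homo-· x y x-perm y-perm =
    sym (inverseʳ-unique (x · y) (·-isPerm x y x-perm y-perm) (inv y · inv x) (begin
    (x · y) · (inv y · inv x)     ≡⟨ ·-assoc (x · y) (inv y) (inv x) ⟨
    ((x · y) // y) · inv x        ≡⟨ cong (_· inv x) (x·y//y≡x x y y-perm) ⟩
    x // x                        ≡⟨ ·-inverseʳ x x-perm ⟩
    idP                           ∎))
    where open ≡-Reasoning

  xz//yz≡x//y : ∀ (x y z : Perm n) → IsPerm y → IsPerm z → (x · z) // (y · z) ≡ x // y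
  xz//yz≡x//y x y z y-perm z-perm = begin
    (x · z) · inv (y · z)         ≡⟨ cong ((x · z) ·_) (inv-anti-homo-· y z y-perm z-perm) ⟩
    (x · z) · (inv z · inv y)     ≡⟨ ·-assoc (x · z) (inv z) (inv y) ⟨
    ((x · z) // z) · inv y        ≡⟨ cong (_· inv y) (x·y//y≡x x z z-perm) ⟩
    x // y                        ∎
    where open ≡-Reasoning

agree⇒//-fixes : ∀ {n} (g h : Perm n) → IsPerm h → ∀ ω → ω ^ g ≡ ω ^ h → ω ^ (g // h) ≡ ω
agree⇒//-fixes g h h-perm ω eq = begin
  ω ^ (g · inv h)    ≡⟨ ^-· ω g (inv h) ⟩
  (ω ^ g) ^ inv h    ≡⟨ cong (_^ inv h) eq ⟩
  (ω ^ h) ^ inv h    ≡⟨ ^-inverseˡ h h-perm ω ⟩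
  ω                  ∎
  where open ≡-Reasoning

infix 4 _∈?_

_∈?_ : ∀ {n} (g : Perm n) (gs : List (Perm n)) → Dec (g ∈ gs)
_∈?_ = DecMembership._∈?_ (≡-dec _≟_)

¬derangement⇒fixesAPoint : ∀ {n} (g : Perm n) → ¬ Derangement g → FixesAPoint g
¬derangement⇒fixesAPoint {n} g ¬der with ¬∀⟶∃¬ n (λ ω → ω ^ g ≢ ω) (λ ω → ¬? (ω ^ g ≟ ω)) ¬der
... | ω , ¬¬fix = ω , decidable-stable (ω ^ g ≟ ω) ¬¬fix

derangement? : ∀ {n} (g : Perm n) → Dec (Derangement g)
derangement? g = all? (λ ω → ¬? (ω ^ g ≟ ω))

intersects? : ∀ {n} (g h : Perm n) → Dec (Intersects g h)
intersects? g h = any? (λ ω → ω ^ g ≟ ω ^ h)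

-- Permutation groups

module _ {n : ℕ} (K : PermGroup n) where

  //-closed : ∀ {g h} → g ∈ elems K → h ∈ elems K → g // h ∈ elems K
  //-closed g∈K h∈K = closed· K g∈K (closedInv K h∈K)

  InH⇒∈ : ∀ {g} → InH K g → g ∈ elems K
  InH⇒∈ (gen g∈K _) = g∈K
  InH⇒∈ gid         = hasId K
  InH⇒∈ (gmul g h)  = closed· K (InH⇒∈ g) (InH⇒∈ h)
  InH⇒∈ (ginv g)    = closedInv K (InH⇒∈ g)

  maxStab-exists : Fin n → ∃[ s ] IsMaxStab K s
  maxStab-exists ω₀ = |stab| best , (best , refl) ,
    λ ω → All.lookup (f[xs]≤f[argmax] ω₀ (allFin n)) (∈-allFin ω)
    where
    |stab| : Fin n → ℕ
    |stab| ω = length (stab K ω)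
    best : Fin n
    best = argmax |stab| ω₀ (allFin n)

  module _ {R : Perm n → Perm n → Set} (R? : ∀ g h → Dec (R g h)) where

    family? : ∀ F → Dec (Family K R F)
    family? F = map′
      (λ (u , F⊆K , rel) → u , All.lookup F⊆K , λ x∈F y∈F → All.lookup (All.lookup rel x∈F) y∈F)
      (λ (u , F⊆K , rel) → u , All.tabulate F⊆K , All.tabulate (λ x∈F → All.tabulate (rel x∈F)))
      (DecUnique.unique? (≡-dec _≟_) F ×-dec All.all? (_∈? elems K) F ×-dec
       All.all? (λ g → All.all? (R? g) F) F)

    -- Filtering elems K by membership in a family F yields a sublist of elems K with the same
    -- elements as F, so the longest family among the sublists bounds every family.
    maxFamily-exists : ∃[ m ] IsMaxFamilySize K R m
    maxFamily-exists = length best , (best , best-family , refl) , bound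
      where
      candidates : List (List (Perm n))
      candidates = filter family? (sublists (elems K))
      best : List (Perm n)
      best = argmax length [] candidates
      best-family : Family K R best
      best-family = argmax-all length ([] , (λ ()) , λ ()) (All.all-filter family? (sublists (elems K)))
      bound : ∀ F → Family K R F → length F ≤ length best
      bound F (u , F⊆K , rel) = subst (_≤ length best) (⊆-antisym⇒length≡ u′ u (proj₂ ∘ in-F′) in-F)
          (All.lookup (f[xs]≤f[argmax] {f = length} [] candidates)
                      (∈-filter⁺ family? (filter∈sublists (_∈? F) (elems K)) family-F′))
        where
        F′ : List (Perm n)
        F′ = filter (_∈? F) (elems K)
        in-F′ : ∀ {x} → x ∈ F′ → x ∈ elems K × x ∈ F
        in-F′ = ∈-filter⁻ (_∈? F) {xs = elems K}
        in-F : F ⊆ F′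
        in-F x∈F = ∈-filter⁺ (_∈? F) (F⊆K x∈F) x∈F
        u′ : Unique F′
        u′ = Unique.filter⁺ (_∈? F) (unique K)
        family-F′ : Family K R F′
        family-F′ = u′ , proj₁ ∘ in-F′ , λ x∈ y∈ → rel (proj₂ (in-F′ x∈)) (proj₂ (in-F′ y∈))

Semiregular : ∀ {n} → PermGroup n → Set
Semiregular {n} K = ∀ {g} → g ∈ elems K → ∀ (ω : Fin n) → ω ^ g ≡ ω → g ≡ idP

module _ {n : ℕ} (K : PermGroup n) (semiregular : Semiregular K) where

  semiregular-agree⇒≡ : ∀ {g h} → g ∈ elems K → h ∈ elems K → ∀ ω → ω ^ g ≡ ω ^ h → g ≡ h
  semiregular-agree⇒≡ {g} {h} g∈K h∈K ω eq = x//y≡idP⇒x≡y h (perms K h∈K)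
    (semiregular (//-closed K g∈K h∈K) ω (agree⇒//-fixes g h (perms K h∈K) ω eq))

  semiregular⇒complete : IsComplete K
  semiregular⇒complete {g} {h} g∈K h∈K g≢h ω fix =
    g≢h (x//y≡idP⇒x≡y h (perms K h∈K) (semiregular (//-closed K g∈K h∈K) ω fix))

  semiregular⇒maxIntersecting≡1 : Fin n → IsMaxIntersecting K 1
  semiregular⇒maxIntersecting≡1 ω = (idP ∷ [] , singleton , refl) , atMostOne
    where
    singleton : Family K Intersects (idP ∷ [])
    singleton = All.[] ∷ [] , (λ { (here refl) → hasId K }) , (λ { (here refl) (here refl) → ω , refl })
    atMostOne : ∀ F → Family K Intersects F → length F ≤ 1
    atMostOne F (unique-F , F⊆K , intersecting) =
      injectiveOn⇒length≤ {ys = idP {n} ∷ []} (λ _ → idP) unique-F (λ _ → here refl)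
        (λ x∈F y∈F _ → let (ω′ , eq) = intersecting x∈F y∈F in
                       semiregular-agree⇒≡ (F⊆K x∈F) (F⊆K y∈F) ω′ eq)

  semiregular⇒|stab|≡1 : ∀ ω → length (stab K ω) ≡ 1
  semiregular⇒|stab|≡1 ω = ⊆-antisym⇒length≡ (Unique.filter⁺ fixes? (unique K)) (All.[] ∷ [])
    (λ g∈stab → let (g∈K , fix) = ∈-filter⁻ fixes? g∈stab in here (semiregular g∈K ω fix))
    (λ { (here refl) → ∈-filter⁺ fixes? (hasId K) (^-idP ω) })
    where
    fixes? : ∀ g → Dec (ω ^ g ≡ ω)
    fixes? g = ω ^ g ≟ ω

  semiregular⇒ρ≡1 : Fin n → RhoIs K 1 1
  semiregular⇒ρ≡1 ω =
    semiregular⇒maxIntersecting≡1 ω , (ω , semiregular⇒|stab|≡1 ω) , ≤-reflexive ∘ semiregular⇒|stab|≡1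

  regular⇒order≡degree : Transitive K → Fin n → order K ≡ n
  regular⇒order≡degree transitive z = trans (≤-antisym orbit-map orbit-choice) (length-tabulate id)
    where
    witness : Fin n → Perm n
    witness j = proj₁ (transitive z j)
    orbit-map : order K ≤ length (allFin n)
    orbit-map = injectiveOn⇒length≤ (z ^_) (unique K) (λ _ → ∈-allFin _)
      (λ g∈K h∈K eq → semiregular-agree⇒≡ g∈K h∈K z eq)
    orbit-choice : length (allFin n) ≤ order K
    orbit-choice = injectiveOn⇒length≤ witness (Unique.allFin⁺ n) (λ {j} _ → proj₁ (proj₂ (transitive z j)))
      (λ {i} {j} _ _ eq → trans (sym (proj₂ (proj₂ (transitive z i))))
                               (trans (cong (z ^_) eq) (proj₂ (proj₂ (transitive z j)))))

  regular⇒EKR : Transitive K → Fin n → EKR K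
  regular⇒EKR transitive ω = 1 , semiregular⇒maxIntersecting≡1 ω ,
    trans (*-identityˡ n) (sym (regular⇒order≡degree transitive ω))

-- Joins of derangement graphs

another-index : ∀ {k} → 2 ≤ k → (i : Fin k) → ∃[ j ] (j ≢ i)
another-index (s≤s (s≤s _)) Fin.zero    = Fin.suc Fin.zero , λ ()
another-index (s≤s (s≤s _)) (Fin.suc _) = Fin.zero , λ ()

module _ {n k : ℕ} {K : PermGroup n} {part : Fin k → List (Perm n)} (join : JoinDecomp K k part) where

  private
    part⊆K : ∀ i {g} → g ∈ part i → g ∈ elems K
    part⊆K = proj₁ join
    cover : ∀ {g} → g ∈ elems K → ∃[ i ] (g ∈ part i)
    cover = proj₁ (proj₂ join)
    disjoint : ∀ i j {g} → i ≢ j → g ∈ part i → g ∉ part j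
    disjoint = proj₁ (proj₂ (proj₂ join))
    adjacent : ∀ i j {x y} → i ≢ j → x ∈ part i → y ∈ part j → Adj x y
    adjacent = proj₂ (proj₂ (proj₂ join))

  nonadjacent⇒samePart : ∀ {a x i} → a ∈ elems K → x ∈ part i → ¬ Adj a x → a ∈ part i
  nonadjacent⇒samePart {i = i} a∈K x∈i ¬adj with cover a∈K
  ... | j , a∈j with j ≟ i
  ...   | yes refl = a∈j
  ...   | no  j≢i  = contradiction (adjacent j i j≢i a∈j x∈i) ¬adj

  InH-preservesPart : ∀ {g x i} → InH K g → x ∈ part i → g · x ∈ part i
  InH-preservesPart {x = x} (gen {g} g∈K (ω , fix)) x∈i =
    nonadjacent⇒samePart (closed· K g∈K (part⊆K _ x∈i)) x∈i
      (λ adj → adj ω (trans (cong (ω ^_) (x·y//y≡x g x (perms K (part⊆K _ x∈i)))) fix))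
  InH-preservesPart {x = x} gid x∈i = subst (_∈ part _) (sym (·-identityˡ x)) x∈i
  InH-preservesPart {x = x} (gmul {g} {h} g∈H h∈H) x∈i =
    subst (_∈ part _) (sym (·-assoc g h x)) (InH-preservesPart g∈H (InH-preservesPart h∈H x∈i))
  InH-preservesPart {x = x} {i} (ginv {g} g∈H) x∈i
    with cover (closed· K (closedInv K (InH⇒∈ K g∈H)) (part⊆K i x∈i))
  ... | j , g⁻¹x∈j with j ≟ i
  ...   | yes refl = g⁻¹x∈j
  ...   | no  j≢i  =
    contradiction x∈i (disjoint j i j≢i (subst (_∈ part j) g·g⁻¹x≡x (InH-preservesPart g∈H g⁻¹x∈j)))
    where
    g·g⁻¹x≡x : g · (inv g · x) ≡ x
    g·g⁻¹x≡x = begin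
      g · (inv g · x)     ≡⟨ ·-assoc g (inv g) x ⟨
      (g · inv g) · x     ≡⟨ cong (_· x) (·-inverseʳ g (perms K (InH⇒∈ K g∈H))) ⟩
      idP · x             ≡⟨ ·-identityˡ x ⟩
      x                   ∎
      where open ≡-Reasoning

generatedByPointFixers⇒¬join : ∀ {n} {K : PermGroup n} → (∀ {g} → g ∈ elems K → InH K g) → ¬ IsJoin K
generatedByPointFixers⇒¬join {K = K} all-InH (k , part , 2≤k , join@(part⊆K , cover , disjoint , _) , nonempty)
  with cover (hasId K)
... | i , 1∈i with another-index 2≤k i
...   | j , j≢i with nonempty j
...     | y , y∈j = disjoint j i j≢i y∈j
                      (subst (_∈ part i) (·-identityʳ y) (InH-preservesPart join (all-InH (part⊆K j y∈j)) 1∈i))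

module RightCosets {n : ℕ} (G H : PermGroup n) (H⊆G : ∀ {g} → g ∈ elems H → g ∈ elems G) where

  _~_ : Perm n → Perm n → Set
  x ~ y = x // y ∈ elems H

  _~?_ : ∀ x y → Dec (x ~ y)
  x ~? y = x // y ∈? elems H

  ~-refl : ∀ {x} → x ∈ elems G → x ~ x
  ~-refl {x} x∈G = subst (_∈ elems H) (sym (·-inverseʳ x (perms G x∈G))) (hasId H)

  ~-sym : ∀ {x y} → x ∈ elems G → y ∈ elems G → x ~ y → y ~ x
  ~-sym {x} {y} x∈G y∈G x~y =
    subst (_∈ elems H) (inv-anti-homo-// x y (perms G x∈G) (perms G y∈G)) (closedInv H x~y)

  ~-trans : ∀ {x y z} → y ∈ elems G → x ~ y → y ~ z → x ~ z
  ~-trans {x} {y} {z} y∈G x~y y~z =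
    subst (_∈ elems H) (x//y·y//z≡x//z x y z (perms G y∈G)) (closed· H x~y y~z)

  ~-∈ : ∀ {x y} → y ∈ elems G → x ~ y → x ∈ elems G
  ~-∈ {x} {y} y∈G x~y = subst (_∈ elems G) (x//y·y≡x x y (perms G y∈G)) (closed· G (H⊆G x~y) y∈G)

  coset : Perm n → List (Perm n)
  coset r = map (_· r) (elems H)

  coset⇒~ : ∀ {r x} → r ∈ elems G → x ∈ coset r → x ~ r
  coset⇒~ {r} r∈G x∈Hr with ∈-map⁻ (_· r) x∈Hr
  ... | h , h∈H , refl = subst (_∈ elems H) (sym (x·y//y≡x h r (perms G r∈G))) h∈H

  ~⇒coset : ∀ {r x} → r ∈ elems G → x ~ r → x ∈ coset r
  ~⇒coset {r} {x} r∈G x~r = subst (_∈ coset r) (x//y·y≡x x r (perms G r∈G)) (∈-map⁺ (_· r) x~r)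

  coset-unique : ∀ {r} → r ∈ elems G → Unique (coset r)
  coset-unique {r} r∈G = Unique.map⁺ (·-cancelʳ r (perms G r∈G)) (unique H)

  reps : List (Perm n)
  reps = deduplicate _~?_ (elems G)

  reps⊆G : ∀ {r} → r ∈ reps → r ∈ elems G
  reps⊆G = ∈-deduplicate⁻ _~?_ (elems G)

  ~-resp : ∀ {g x y} → y ~ x → x ∈ elems G × g ~ x → y ∈ elems G × g ~ y
  ~-resp {g} {x} {y} y~x (x∈G , g~x) =
    y∈G , ~-trans {g} {x} {y} x∈G g~x (~-sym y∈G x∈G y~x)
    where
    y∈G = ~-∈ {y} x∈G y~x

  reps-cover : ∀ {g} → g ∈ elems G → ∃[ r ] (r ∈ reps × g ~ r)
  reps-cover {g} g∈G with find {P = λ r → r ∈ elems G × g ~ r}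
                               (Any.deduplicate⁺ _~?_ (~-resp {g}) (lose g∈G (g∈G , ~-refl g∈G)))
  ... | r , r∈reps , (_ , g~r) = r , r∈reps , g~r

  k : ℕ
  k = length reps

  rep : Fin k → Perm n
  rep = lookup reps

  rep∈G : ∀ i → rep i ∈ elems G
  rep∈G i = reps⊆G (∈-lookup i)

  part : Fin k → List (Perm n)
  part i = coset (rep i)

  part⊆G : ∀ i {x} → x ∈ part i → x ∈ elems G
  part⊆G i x∈i = ~-∈ (rep∈G i) (coset⇒~ (rep∈G i) x∈i)

  ~⇒samePart : ∀ {i j x y} → x ∈ part i → y ∈ part j → x ~ y → i ≡ j
  ~⇒samePart {i} {j} {x} {y} x∈i y∈j x~y =
    AllPairs¬⇒lookup-injective (deduplicate-AllPairs¬ _~?_ (elems G)) rᵢ~rⱼ (~-sym (rep∈G i) (rep∈G j) rᵢ~rⱼ)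
    where
    rᵢ~rⱼ : rep i ~ rep j
    rᵢ~rⱼ = ~-trans {rep i} {x} (part⊆G i x∈i) (~-sym (part⊆G i x∈i) (rep∈G i) (coset⇒~ (rep∈G i) x∈i))
              (~-trans {x} {y} {rep j} (part⊆G j y∈j) x~y (coset⇒~ (rep∈G j) y∈j))

  part-cover : ∀ {g} → g ∈ elems G → ∃[ i ] (g ∈ part i)
  part-cover g∈G with reps-cover g∈G
  ... | r , r∈reps , g~r =
    index r∈reps , subst (λ r′ → _ ∈ coset r′) (lookup-index r∈reps) (~⇒coset (reps⊆G r∈reps) g~r)

  part-disjoint : ∀ {i j x} → i ≢ j → x ∈ part i → x ∉ part j
  part-disjoint {i} i≢j x∈i x∈j = i≢j (~⇒samePart x∈i x∈j (~-refl (part⊆G i x∈i)))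

  lagrange : k * order H ≡ order G
  lagrange = sym (partition⇒length≡ part (unique G) part⊆G part-cover part-disjoint
    (λ i → coset-unique (rep∈G i)) (λ i → length-map (_· rep i) (elems H)))

  part-join : (∀ {g} → g ∈ elems G → FixesAPoint g → g ∈ elems H) → JoinDecomp G k part
  part-join fixers⊆H = part⊆G , part-cover , (λ _ _ → part-disjoint) ,
    λ i j {x} {y} i≢j x∈i y∈j ω fix →
      i≢j (~⇒samePart x∈i y∈j (fixers⊆H (//-closed G (part⊆G i x∈i) (part⊆G j y∈j)) (ω , fix)))

  part≅H : ∀ i → InducedIsoTo (part i) H
  part≅H i = (_// r) , coset⇒~ r∈G , (λ _ _ → //-cancelʳ r r-perm) , onto , preservesAdj
    where
    r : Perm n
    r = rep i
    r∈G : r ∈ elems G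
    r∈G = rep∈G i
    r-perm : IsPerm r
    r-perm = perms G r∈G
    onto : ∀ {y} → y ∈ elems H → ∃[ x ] (x ∈ part i × x // r ≡ y)
    onto {y} y∈H = y · r , ∈-map⁺ (_· r) y∈H , x·y//y≡x y r r-perm
    preservesAdj : ∀ {x y} → x ∈ part i → y ∈ part i →
                   (Adj x y → Adj (x // r) (y // r)) × (Adj (x // r) (y // r) → Adj x y)
    preservesAdj {x} {y} _ y∈i = subst Derangement (sym shift) , subst Derangement shift
      where
      shift : (x // r) // (y // r) ≡ x // y
      shift = xz//yz≡x//y x y (inv r) (perms G (part⊆G i y∈i)) (inv-isPerm r r-perm)

module PointFixerSubgroup {n : ℕ} (G H : PermGroup n) (isH : IsH G H) where

  H⊆G : ∀ {g} → g ∈ elems H → g ∈ elems G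
  H⊆G {g} g∈H = InH⇒∈ G (proj₁ (isH g) g∈H)

  fixer∈H : ∀ {g} → g ∈ elems G → FixesAPoint g → g ∈ elems H
  fixer∈H {g} g∈G fix = proj₂ (isH g) (gen g∈G fix)

  trivial⇒semiregular : (∀ {g} → g ∈ elems H → g ≡ idP) → Semiregular G
  trivial⇒semiregular trivial g∈G ω fix = trivial (fixer∈H g∈G (ω , fix))

  maxFamily-transfer : ∀ {R : Perm n → Perm n → Set} →
                       (∀ {x y} → x ∈ elems G → y ∈ elems G → R x y → FixesAPoint (x // y)) →
                       (∀ {x y c} → x ∈ elems G → y ∈ elems G → c ∈ elems G → R x y → R (x · c) (y · c)) →
                       ∀ {m} → IsMaxFamilySize H R m → IsMaxFamilySize G R m
  maxFamily-transfer {R} R⇒fixes invariant {m} ((F , (u , F⊆H , rel) , len) , bound) =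
    (F , (u , H⊆G ∘ F⊆H , rel) , len) , boundG
    where
    boundG : ∀ F → Family G R F → length F ≤ m
    boundG []         _                  = z≤n
    boundG F@(x₀ ∷ _) (u , F⊆G , relF) =
      subst (_≤ m) (length-map (_// x₀) F) (bound (map (_// x₀) F) translated)
      where
      x₀∈G : x₀ ∈ elems G
      x₀∈G = F⊆G (here refl)
      translated : Family H R (map (_// x₀) F)
      translated = Unique.map⁺ (//-cancelʳ x₀ (perms G x₀∈G)) u , into-H , related
        where
        into-H : ∀ {y} → y ∈ map (_// x₀) F → y ∈ elems H
        into-H y∈ with ∈-map⁻ (_// x₀) y∈
        ... | x , x∈F , refl =
          fixer∈H (//-closed G (F⊆G x∈F) x₀∈G) (R⇒fixes (F⊆G x∈F) x₀∈G (relF x∈F (here refl)))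
        related : ∀ {y z} → y ∈ map (_// x₀) F → z ∈ map (_// x₀) F → R y z
        related y∈ z∈ with ∈-map⁻ (_// x₀) y∈ | ∈-map⁻ (_// x₀) z∈
        ... | x , x∈F , refl | x′ , x′∈F , refl =
          invariant (F⊆G x∈F) (F⊆G x′∈F) (closedInv G x₀∈G) (relF x∈F x′∈F)

  α-transfer : ∀ {a} → IsAlpha H a → IsAlpha G a
  α-transfer = maxFamily-transfer (λ {x} {y} _ _ → ¬derangement⇒fixesAPoint (x // y))
    (λ {x} {y} {c} _ y∈G c∈G ¬adj adj →
       ¬adj (subst Derangement (xz//yz≡x//y x y c (perms G y∈G) (perms G c∈G)) adj))

  maxIntersecting-transfer : ∀ {m} → IsMaxIntersecting H m → IsMaxIntersecting G m
  maxIntersecting-transfer = maxFamily-transfer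
    (λ {x} {y} _ y∈G (ω , eq) → ω , agree⇒//-fixes x y (perms G y∈G) ω eq)
    (λ {x} {y} {c} _ _ _ (ω , eq) → ω , trans (^-· ω x c) (trans (cong (_^ c) eq) (sym (^-· ω y c))))

  |stab|-equal : ∀ ω → length (stab G ω) ≡ length (stab H ω)
  |stab|-equal ω = ⊆-antisym⇒length≡ (Unique.filter⁺ fixes? (unique G)) (Unique.filter⁺ fixes? (unique H))
    (λ g∈ → let (g∈G , fix) = ∈-filter⁻ fixes? {xs = elems G} g∈ in
            ∈-filter⁺ fixes? (fixer∈H g∈G (ω , fix)) fix)
    (λ g∈ → let (g∈H , fix) = ∈-filter⁻ fixes? {xs = elems H} g∈ in
            ∈-filter⁺ fixes? (H⊆G g∈H) fix)
    where
    fixes? : ∀ g → Dec (ω ^ g ≡ ω)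
    fixes? g = ω ^ g ≟ ω

  maxStab-transfer : ∀ {s} → IsMaxStab H s → IsMaxStab G s
  maxStab-transfer ((ω , len) , bound) =
    (ω , trans (|stab|-equal ω) len) , λ ω′ → subst (_≤ _) (sym (|stab|-equal ω′)) (bound ω′)

theorem2p10 : ∀ (n : ℕ) → 0 < n → (G H : PermGroup n) → Transitive G → IsH G H →
    ((∀ (g : Perm n) → (g ∈ elems H → g ≡ idP) × (g ≡ idP → g ∈ elems H)) →
        IsComplete G × Regular G × EKR G × (∃[ m ] ∃[ s ] (RhoIs G m s × m ≡ s)))
  × ((∃[ g ] (g ∈ elems G × g ∉ elems H)) →
        (∃[ k ] (k * order H ≡ order G × IsJoinOfCopies G k H))
      × (∃[ a ] (IsAlpha G a × IsAlpha H a))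
      × (∃[ mG ] ∃[ sG ] ∃[ mH ] ∃[ sH ] (RhoIs G mG sG × RhoIs H mH sH × mG * sH ≡ mH * sG)))
  × ((∀ {g : Perm n} → g ∈ elems G → g ∈ elems H) → ¬ IsJoin G)
theorem2p10 n 0<n G H transitive isH = trivialCase , properCase , fullCase
  where
  open PointFixerSubgroup G H isH
  open RightCosets G H H⊆G

  ω₀ : Fin n
  ω₀ = fromℕ< 0<n

  trivialCase : (∀ g → (g ∈ elems H → g ≡ idP) × (g ≡ idP → g ∈ elems H)) →
                IsComplete G × Regular G × EKR G × (∃[ m ] ∃[ s ] (RhoIs G m s × m ≡ s))
  trivialCase trivial =
    semiregular⇒complete G semiregular , (transitive , semiregular) ,
    regular⇒EKR G semiregular transitive ω₀ , 1 , 1 , semiregular⇒ρ≡1 G semiregular ω₀ , refl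
    where
    semiregular : Semiregular G
    semiregular = trivial⇒semiregular (λ {g} → proj₁ (trivial g))

  properCase : (∃[ g ] (g ∈ elems G × g ∉ elems H)) →
               (∃[ k ] (k * order H ≡ order G × IsJoinOfCopies G k H))
             × (∃[ a ] (IsAlpha G a × IsAlpha H a))
             × (∃[ mG ] ∃[ sG ] ∃[ mH ] ∃[ sH ] (RhoIs G mG sG × RhoIs H mH sH × mG * sH ≡ mH * sG))
  -- The coset argument does not use H ≠ G (for H = G it gives a single part).
  properCase _ with maxFamily-exists H (λ g h → ¬? (derangement? (g // h)))
                  | maxFamily-exists H intersects? | maxStab-exists H ω₀
  ... | a , α-H | m , ι-H | s , σ-H =
    (k , lagrange , part , part-join fixer∈H , part≅H) ,
    (a , α-transfer α-H , α-H) ,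
    (m , s , m , s , (maxIntersecting-transfer ι-H , maxStab-transfer σ-H) , (ι-H , σ-H) , refl)

  fullCase : (∀ {g} → g ∈ elems G → g ∈ elems H) → ¬ IsJoin G
  fullCase G⊆H = generatedByPointFixers⇒¬join (λ {g} g∈G → proj₁ (isH g) (G⊆H g∈G))
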